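{- Let $G$, $s$, $t$, $k$, canonical paths $P_1,\dots,P_k$ and minimum $s$-$t$-separators $A,B$ be as in the context, with $u_{i,a_i}$ and $u_{i,b_i}$ the unique vertices of $A$ and $B$ on $P_i$, and $l_i=\min(a_i,b_i)$, $r_i=\max(a_i,b_i)$. For each $i\in[k]$ define, for $1<a<L(i)$, $\phi_i(a)=l_i$ if $a<l_i$, $\phi_i(a)=r_i$ if $a>r_i$, and $\phi_i(a)=a$ otherwise, and let $f(u_{i,a})=u_{i,\phi_i(a)}$. Then for every minimum $s$-$t$-separator $X$, the image $f(X)$ is a minimum $s$-$t$-separator.
   Context: Graphs are finite, simple, undirected; $s,t$ non-adjacent. An $s$-$t$-separator is a set $S\subseteq V(G)\setminus\{s,t\}$ such that $s,t$ are in different components of $G-S$; minimum means of minimum size, denoted $k$. Canonical paths: a fixed set of $k$ pairwise internally vertex-disjoint chordless $s$-$t$-paths $P_1,\dots,P_k$ (chordless: every edge of $G$ between two vertices of $P_i$ is an edge of $P_i$). Each minimum $s$-$t$-separator contains exactly one vertex of each $P_i$. $L(i)$ is the number of vertices of $P_i$ (including $s,t$), and $u_{i,1}=s,u_{i,2},\dots,u_{i,L(i)}=t$ are the vertices of $P_i$ in order. -}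

module Defs where

open import Level using (0ℓ)
open import Data.Nat using (ℕ; suc; _≤_; _<_; _<ᵇ_; _⊓_; _⊔_)
open import Data.Bool using (if_then_else_)
open import Data.Fin using (Fin)
open import Data.Fin.Subset using (Subset; _∈_; _∉_; ∣_∣)
open import Data.Product using (_×_; ∃-syntax)
open import Data.Sum using (_⊎_)
open import Relation.Binary.PropositionalEquality using (_≡_; _≢_)
open import Relation.Nullary using (¬_)

record SimpleGraph (n : ℕ) : Set₁ where
  field
    E     : Fin n → Fin n → Set
    sym   : ∀ {x y} → E x y → E y x
    irrfl : ∀ {x} → ¬ E x x

module _ {n : ℕ} (G : SimpleGraph n) where
  open SimpleGraph G

  data Reach (S : Subset n) (x : Fin n) : Fin n → Set where
    here : x ∉ S → Reach S x x
    step : ∀ {y z} → Reach S x y → E y z → z ∉ S → Reach S x z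

  IsSep : Fin n → Fin n → Subset n → Set
  IsSep s t S = s ∉ S × t ∉ S × ¬ Reach S s t

  IsMinSep : Fin n → Fin n → Subset n → Set
  IsMinSep s t S = IsSep s t S × (∀ T → IsSep s t T → ∣ S ∣ ≤ ∣ T ∣)

  -- Path i has L i vertices u i 1 = s, ..., u i (L i) = t (1-based positions;
  -- values of u i at positions outside [1, L i] are irrelevant).
  record CanonicalPaths (s t : Fin n) (k : ℕ) : Set where
    field
      L     : Fin k → ℕ
      u     : Fin k → ℕ → Fin n
      L≥2   : ∀ i → 2 ≤ L i
      start : ∀ i → u i 1 ≡ s
      end   : ∀ i → u i (L i) ≡ t
      edge  : ∀ i a → 1 ≤ a → a < L i → E (u i a) (u i (suc a))
      inj   : ∀ i a b → 1 ≤ a → a ≤ L i → 1 ≤ b → b ≤ L i →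
              u i a ≡ u i b → a ≡ b
      chordless : ∀ i a b → 1 ≤ a → a ≤ L i → 1 ≤ b → b ≤ L i →
              E (u i a) (u i b) → (b ≡ suc a) ⊎ (a ≡ suc b)
      disjoint : ∀ i j a b → i ≢ j → 1 < a → a < L i → 1 < b → b < L j →
              u i a ≢ u j b

phi : ℕ → ℕ → ℕ → ℕ
phi l r a = if a <ᵇ l then l else (if r <ᵇ a then r else a)

-- Let R(S) be the set of vertices reachable from s in G − S. A minimum separator S meets each
-- canonical path P_i in exactly one vertex u_{i,σ_i}, and R(S) ∩ P_i is the part of P_i before σ_i.
-- The zone Z = (R(A) ∪ R(B)) ∩ (R(X) ∪ (R(A) ∩ R(B))) contains s but not t, and every edge leaving Z
-- ends in f(X): a neighbour of Z off the separators simply extends the reach sets, while a neighbour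
-- u_{i,y} on P_i satisfies y ≤ r_i and (y ≤ ξ_i or y ≤ l_i), where ξ_i is the position of X on P_i;
-- unless y = φ_i(ξ_i) these inequalities are strict, which puts u_{i,y} back into Z. Hence f(X)
-- separates s from t, and as the image of the k vertices of X it has at most k = |A| elements.
module Submission where

open import Defs
open import Data.Bool using (true; false; T)
open import Data.Empty using (⊥-elim)
open import Data.Fin using (Fin; zero; suc)
open import Data.Fin.Properties using (any?; _≟_; suc-injective; 0≢1+n)
open import Data.Fin.Subset using (Subset; _∈_; _∉_; ∣_∣; _-_; ⊥; inside; outside)
open import Data.Fin.Subset.Properties
  using (_∈?_; p─⊥≡p; x∈p∧x≢y⇒x∈p-y; x∈p⇒∣p-x∣<∣p∣; p─q⊆p; p⊆q⇒∣p∣≤∣q∣; ∣⊥∣≡0)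
open import Data.Nat using (ℕ; zero; suc; _≤_; _<_; z≤n; s≤s; _∸_; _+_; _⊓_; _⊔_; _<ᵇ_)
open import Data.Nat.Properties
  using (≤-refl; ≤-reflexive; ≤-trans; <-trans; ≤-<-trans; <-≤-trans; <-irrefl; <-cmp; <⇒≤;
         ≤∧≢⇒<; ≮⇒≥; n≤1+n; n<1+n; m<n⇒m<1+n; m≤n+m; +-suc; m∸n+n≡m; <ᵇ⇒<; <⇒<ᵇ;
         ⊔-sel; ⊔-lub; ⊓-glb; m⊓n≤m⊔n; m≤n⇒m≤n⊔o; m≤n⇒m≤o⊔n; m<n⊓o⇒m<n; m<n⊓o⇒m<o)
open import Data.Product using (_×_; _,_; ∃-syntax; proj₁; proj₂) renaming (map to ×-map)
open import Data.Sum using (_⊎_; inj₁; inj₂; [_,_]) renaming (map to ⊎-map)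
open import Data.Unit using (tt)
open import Data.Vec.Base using (_∷_; there)
open import Function.Base using (_∘_)
open import Function.Bundles using (_⇔_; Equivalence)
open import Function.Definitions using (Injective)
open import Relation.Binary.Definitions using (tri<; tri≈; tri>)
open import Relation.Binary.PropositionalEquality using (_≡_; _≢_; refl; sym; trans; cong; subst)
open import Relation.Nullary using (¬_; yes; no)

∣p∣≤1+∣p-x∣ : ∀ {n} (p : Subset n) x → ∣ p ∣ ≤ suc ∣ p - x ∣
∣p∣≤1+∣p-x∣ (inside  ∷ p) zero    = subst (λ q → suc ∣ p ∣ ≤ suc ∣ q ∣) (sym (p─⊥≡p p)) ≤-refl
∣p∣≤1+∣p-x∣ (outside ∷ p) zero    = subst (λ q → ∣ p ∣ ≤ suc ∣ q ∣) (sym (p─⊥≡p p)) (n≤1+n _)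
∣p∣≤1+∣p-x∣ (inside  ∷ p) (suc x) = s≤s (∣p∣≤1+∣p-x∣ p x)
∣p∣≤1+∣p-x∣ (outside ∷ p) (suc x) = ∣p∣≤1+∣p-x∣ p x

x∉p-x : ∀ {n} (p : Subset n) x → x ∉ p - x
x∉p-x (_ ∷ p) (suc x) (there x∈p-x) = x∉p-x p x x∈p-x

injection⇒≤∣p∣ : ∀ {m n} (f : Fin m → Fin n) {p : Subset n} →
                 Injective _≡_ _≡_ f → (∀ i → f i ∈ p) → m ≤ ∣ p ∣
injection⇒≤∣p∣ {zero}  f f-inj f∈p = z≤n
injection⇒≤∣p∣ {suc m} f {p} f-inj f∈p =
  ≤-<-trans (injection⇒≤∣p∣ (λ i → f (suc i)) (λ eq → suc-injective (f-inj eq)) f∘suc∈p-f₀)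
            (x∈p⇒∣p-x∣<∣p∣ (f∈p zero))
  where
  f∘suc∈p-f₀ : ∀ i → f (suc i) ∈ p - f zero
  f∘suc∈p-f₀ i = x∈p∧x≢y⇒x∈p-y (f∈p (suc i)) (λ eq → 0≢1+n (sym (f-inj eq)))

⊆image⇒∣p∣≤ : ∀ {m n} (g : Fin m → Fin n) {p : Subset n} →
              (∀ {y} → y ∈ p → ∃[ i ] y ≡ g i) → ∣ p ∣ ≤ m
⊆image⇒∣p∣≤ {zero} {n} g p⊆img =
  ≤-trans (p⊆q⇒∣p∣≤∣q∣ (λ y∈p → empty (p⊆img y∈p))) (≤-reflexive (∣⊥∣≡0 n))
  where
  empty : ∀ {y} → ∃[ i ] y ≡ g i → y ∈ ⊥
  empty (() , _)
⊆image⇒∣p∣≤ {suc m} g {p} p⊆img =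
  ≤-trans (∣p∣≤1+∣p-x∣ p (g zero)) (s≤s (⊆image⇒∣p∣≤ (λ i → g (suc i)) p-g₀⊆img))
  where
  p-g₀⊆img : ∀ {y} → y ∈ p - g zero → ∃[ i ] y ≡ g (suc i)
  p-g₀⊆img {y} y∈p-g₀ with p⊆img (p─q⊆p p _ y∈p-g₀)
  ... | zero  , refl = ⊥-elim (x∉p-x p (g zero) y∈p-g₀)
  ... | suc i , y≡gi = i , y≡gi

injection⇒⊆image : ∀ {m n} (f : Fin m → Fin n) {p : Subset n} → Injective _≡_ _≡_ f →
                   (∀ i → f i ∈ p) → ∣ p ∣ ≤ m → ∀ {y} → y ∈ p → ∃[ i ] y ≡ f i
injection⇒⊆image {m} f {p} f-inj f∈p ∣p∣≤m {y} y∈p with any? (λ i → y ≟ f i)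
... | yes y∈img = y∈img
... | no  y∉img = ⊥-elim (<-irrefl refl (≤-trans (injection⇒≤∣p∣ g g-inj g∈p) ∣p∣≤m))
  where
  g : Fin (suc m) → Fin _
  g zero    = y
  g (suc i) = f i
  g-inj : Injective _≡_ _≡_ g
  g-inj {zero}  {zero}  _  = refl
  g-inj {zero}  {suc j} eq = ⊥-elim (y∉img (j , eq))
  g-inj {suc i} {zero}  eq = ⊥-elim (y∉img (i , sym eq))
  g-inj {suc i} {suc j} eq = cong suc (f-inj eq)
  g∈p : ∀ i → g i ∈ p
  g∈p zero    = y∈p
  g∈p (suc i) = f∈p i

m<n⊔o⇒m<n⊎m<o : ∀ {m} n o → m < n ⊔ o → m < n ⊎ m < o
m<n⊔o⇒m<n⊎m<o {m} n o m<n⊔o =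
  ⊎-map (λ eq → subst (m <_) eq m<n⊔o) (λ eq → subst (m <_) eq m<n⊔o) (⊔-sel n o)

data Clamp (l r x : ℕ) : ℕ → Set where
  below  : x < l → Clamp l r x l
  above  : l ≤ x → r < x → Clamp l r x r
  within : l ≤ x → x ≤ r → Clamp l r x x

clamp : ∀ l r x → Clamp l r x (phi l r x)
clamp l r x with x <ᵇ l in x<ᵇl
... | true  = below (<ᵇ⇒< x l (subst T (sym x<ᵇl) tt))
... | false with r <ᵇ x in r<ᵇx
...   | true  = above (≮⇒≥ λ x<l → subst T x<ᵇl (<⇒<ᵇ x<l)) (<ᵇ⇒< r x (subst T (sym r<ᵇx) tt))
...   | false = within (≮⇒≥ λ x<l → subst T x<ᵇl (<⇒<ᵇ x<l)) (≮⇒≥ λ r<x → subst T r<ᵇx (<⇒<ᵇ r<x))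

phi-bounds : ∀ {l r} x → l ≤ r → l ≤ phi l r x × phi l r x ≤ r
phi-bounds {l} {r} x l≤r with phi l r x | clamp l r x
... | _ | below _         = ≤-refl , l≤r
... | _ | above _ _       = l≤r , ≤-refl
... | _ | within l≤x x≤r  = l≤x , x≤r

≤∧≢phi⇒< : ∀ {l r x y} → l ≤ r → y ≤ r → y ≤ x ⊎ y ≤ l → y ≢ phi l r x →
           y < r × (y < x ⊎ y < l)
≤∧≢phi⇒< {l} {r} {x} {y} l≤r y≤r y≤x∨l y≢φ with phi l r x | clamp l r x
... | _ | below x<l = <-≤-trans y<l l≤r , inj₂ y<l
  where y<l = [ (λ y≤x → ≤-<-trans y≤x x<l) , (λ y≤l → ≤∧≢⇒< y≤l y≢φ) ] y≤x∨l
... | _ | above _ r<x = ≤∧≢⇒< y≤r y≢φ , inj₁ (≤-<-trans y≤r r<x)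
... | _ | within l≤x x≤r = <-≤-trans y<x x≤r , inj₁ y<x
  where y<x = ≤∧≢⇒< ([ (λ y≤x → y≤x) , (λ y≤l → ≤-trans y≤l l≤x) ] y≤x∨l) y≢φ

reach-∉ : ∀ {n} {G : SimpleGraph n} {S x w} → Reach G S x w → w ∉ S
reach-∉ (here w∉S)     = w∉S
reach-∉ (step _ _ w∉S) = w∉S

module Paths {n} (G : SimpleGraph n) {s t : Fin n} {k} (P : CanonicalPaths G s t k) where
  open SimpleGraph G using (E)
  open CanonicalPaths P

  Reachable : Subset n → Fin n → Set
  Reachable S = Reach G S s

  MeetsAt : Subset n → Fin k → ℕ → Set
  MeetsAt S i x = 1 ≤ x × x ≤ L i × u i x ∈ S

  inner≢s : ∀ {i x} → 1 < x → x ≤ L i → u i x ≢ s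
  inner≢s {i} {x} 1<x x≤L ux≡s =
    <-irrefl (inj i 1 x ≤-refl (<⇒≤ (L≥2 i)) (<⇒≤ 1<x) x≤L (trans (start i) (sym ux≡s))) 1<x

  inner≢t : ∀ {i x} → 1 ≤ x → x < L i → u i x ≢ t
  inner≢t {i} {x} 1≤x x<L ux≡t =
    <-irrefl (inj i x (L i) 1≤x (<⇒≤ x<L) (<⇒≤ (L≥2 i)) ≤-refl (trans ux≡t (sym (end i)))) x<L

  reach-start : ∀ {S} i → s ∉ S → Reachable S (u i 1)
  reach-start {S} i s∉S = subst (Reachable S) (sym (start i)) (here s∉S)

  ∈separator⇒1< : ∀ {S i x} → IsSep G s t S → 1 ≤ x → u i x ∈ S → 1 < x
  ∈separator⇒1< {S} {i} (s∉S , _) 1≤x ux∈S =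
    ≤∧≢⇒< 1≤x λ { refl → s∉S (subst (_∈ S) (start i) ux∈S) }

  ∈separator⇒<L : ∀ {S i x} → IsSep G s t S → x ≤ L i → u i x ∈ S → x < L i
  ∈separator⇒<L {S} {i} (_ , t∉S , _) x≤L ux∈S =
    ≤∧≢⇒< x≤L λ { refl → t∉S (subst (_∈ S) (end i) ux∈S) }

  meets-or-reaches : ∀ {S} → s ∉ S → ∀ i y → 1 ≤ y → y ≤ L i →
                     (∃[ x ] MeetsAt S i x) ⊎ Reachable S (u i y)
  meets-or-reaches s∉S i 1 _ _ = inj₂ (reach-start i s∉S)
  meets-or-reaches {S} s∉S i (suc (suc y)) _ y<L
    with meets-or-reaches s∉S i (suc y) (s≤s z≤n) (<⇒≤ y<L)
  ... | inj₁ meet = inj₁ meet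
  ... | inj₂ reach with u i (suc (suc y)) ∈? S
  ...   | yes u∈S = inj₁ (suc (suc y) , s≤s z≤n , y<L , u∈S)
  ...   | no  u∉S = inj₂ (step reach (edge i (suc y) (s≤s z≤n) y<L) u∉S)

  separator-meets : ∀ {S} → IsSep G s t S → ∀ i → ∃[ x ] MeetsAt S i x
  separator-meets {S} (s∉S , _ , ¬s⇝t) i
    with meets-or-reaches s∉S i (L i) (<⇒≤ (L≥2 i)) ≤-refl
  ... | inj₁ meet  = meet
  ... | inj₂ reach = ⊥-elim (¬s⇝t (subst (Reachable S) (end i) reach))

  record PathTransversal (S : Subset n) : Set where
    field
      separates : IsSep G s t S
      pos       : Fin k → ℕ
      1<pos     : ∀ i → 1 < pos i
      pos<L     : ∀ i → pos i < L i
      pos∈      : ∀ i → u i (pos i) ∈ S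
      ∈⇒pos     : ∀ {w} → w ∈ S → ∃[ i ] w ≡ u i (pos i)

  transversal : ∀ {S} → IsSep G s t S → (σ : Fin k → ℕ) → (∀ i → MeetsAt S i (σ i)) →
                ∣ S ∣ ≤ k → PathTransversal S
  transversal {S} sep σ meets ∣S∣≤k = record
    { separates = sep ; pos = σ ; 1<pos = 1<σ ; pos<L = σ<L ; pos∈ = σ∈
    ; ∈⇒pos = injection⇒⊆image vertex vertex-injective σ∈ ∣S∣≤k }
    where
    σ∈ : ∀ i → u i (σ i) ∈ S
    σ∈ i = proj₂ (proj₂ (meets i))
    1<σ : ∀ i → 1 < σ i
    1<σ i = ∈separator⇒1< sep (proj₁ (meets i)) (σ∈ i)
    σ<L : ∀ i → σ i < L i
    σ<L i = ∈separator⇒<L sep (proj₁ (proj₂ (meets i))) (σ∈ i)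
    vertex : Fin k → Fin n
    vertex i = u i (σ i)
    vertex-injective : Injective _≡_ _≡_ vertex
    vertex-injective {i} {j} eq with i ≟ j
    ... | yes i≡j = i≡j
    ... | no  i≢j = ⊥-elim (disjoint i j (σ i) (σ j) i≢j (1<σ i) (σ<L i) (1<σ j) (σ<L j) eq)

  module _ {S} (T : PathTransversal S) where
    open PathTransversal T

    pos-unique : ∀ {i x} → 1 ≤ x → x ≤ L i → u i x ∈ S → x ≡ pos i
    pos-unique {i} {x} 1≤x x≤L ux∈S with ∈⇒pos ux∈S
    ... | j , eq with i ≟ j
    ...   | yes refl = inj i x (pos i) 1≤x x≤L (<⇒≤ (1<pos i)) (<⇒≤ (pos<L i)) eq
    ...   | no  i≢j  = ⊥-elim (disjoint i j x (pos j) i≢j (∈separator⇒1< separates 1≤x ux∈S)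
                         (∈separator⇒<L separates x≤L ux∈S) (1<pos j) (pos<L j) eq)

    reach-before-pos : ∀ {i x} → 1 ≤ x → x < pos i → Reachable S (u i x)
    reach-before-pos {i} {1} _ _ = reach-start i (proj₁ separates)
    reach-before-pos {i} {suc (suc x)} _ x<pos =
      step (reach-before-pos (s≤s z≤n) (<-trans (n<1+n _) x<pos))
           (edge i (suc x) (s≤s z≤n) x≤L)
           (λ u∈S → <-irrefl (pos-unique (s≤s z≤n) x≤L u∈S) x<pos)
      where x≤L = <⇒≤ (<-trans x<pos (pos<L i))

    reach-beyond-pos⇒reach-t : ∀ {i y} → pos i < y → y ≤ L i → Reachable S (u i y) → Reachable S t
    reach-beyond-pos⇒reach-t {i} {y} pos<y y≤L = go (L i ∸ y) (m∸n+n≡m y≤L) pos<y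
      where
      go : ∀ d {y} → d + y ≡ L i → pos i < y → Reachable S (u i y) → Reachable S t
      go zero    refl _ reach = subst (Reachable S) (end i) reach
      go (suc d) {y} d+y≡L pos<y reach =
        go d (trans (+-suc d y) d+y≡L) (m<n⇒m<1+n pos<y)
           (step reach (edge i y (<⇒≤ (<-trans (1<pos i) pos<y)) y<L)
                 (λ u∈S → <-irrefl (sym (pos-unique (s≤s z≤n) y<L u∈S)) (m<n⇒m<1+n pos<y)))
        where y<L = subst (y <_) d+y≡L (s≤s (m≤n+m y d))

    reach⇒<pos : ∀ {i x} → x ≤ L i → Reachable S (u i x) → x < pos i
    reach⇒<pos {i} {x} x≤L reach with <-cmp x (pos i)
    ... | tri< x<pos _ _ = x<pos
    ... | tri≈ _ refl _  = ⊥-elim (reach-∉ reach (pos∈ i))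
    ... | tri> _ _ pos<x = ⊥-elim (proj₂ (proj₂ separates) (reach-beyond-pos⇒reach-t pos<x x≤L reach))

    edge-from-reach⇒≤pos : ∀ {v i x} → Reachable S v → E v (u i x) → 1 ≤ x → x ≤ L i → x ≤ pos i
    edge-from-reach⇒≤pos {i = i} {x} reach e 1≤x x≤L with u i x ∈? S
    ... | yes u∈S = ≤-reflexive (pos-unique 1≤x x≤L u∈S)
    ... | no  u∉S = <⇒≤ (reach⇒<pos x≤L (step reach e u∉S))

  module Uncrossing {A B X} (TA : PathTransversal A) (TB : PathTransversal B)
                    (TX : PathTransversal X) where
    open PathTransversal

    a b ξ φ : Fin k → ℕ
    a = pos TA
    b = pos TB
    ξ = pos TX
    φ i = phi (a i ⊓ b i) (a i ⊔ b i) (ξ i)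

    1<φ : ∀ i → 1 < φ i
    1<φ i = ≤-trans (⊓-glb (1<pos TA i) (1<pos TB i))
                    (proj₁ (phi-bounds (ξ i) (m⊓n≤m⊔n (a i) (b i))))

    φ<L : ∀ i → φ i < L i
    φ<L i = ≤-<-trans (proj₂ (phi-bounds (ξ i) (m⊓n≤m⊔n (a i) (b i))))
                      (⊔-lub (pos<L TA i) (pos<L TB i))

    Zone : Fin n → Set
    Zone w = (Reachable A w ⊎ Reachable B w) × (Reachable X w ⊎ Reachable A w × Reachable B w)

    s∈Zone : Zone s
    s∈Zone = inj₁ (here s∉A) , inj₂ (here s∉A , here (proj₁ (separates TB)))
      where s∉A = proj₁ (separates TA)

    t∉Zone : ¬ Zone t
    t∉Zone = [ proj₂ (proj₂ (separates TA)) , proj₂ (proj₂ (separates TB)) ] ∘ proj₁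

    Zone-step-outside : ∀ {v w} → Zone v → E v w → w ∉ A → w ∉ B → w ∉ X → Zone w
    Zone-step-outside (inAB , inX) e w∉A w∉B w∉X =
      ⊎-map (λ r → step r e w∉A) (λ r → step r e w∉B) inAB ,
      ⊎-map (λ r → step r e w∉X) (×-map (λ r → step r e w∉A) (λ r → step r e w∉B)) inX

    Zone-step-path : ∀ {v i y} → Zone v → E v (u i y) → y ≢ φ i → 1 < y → y < L i → Zone (u i y)
    Zone-step-path {v} {i} {y} (inAB , inX) e y≢φ 1<y y<L =
      ⊎-map (reach TA) (reach TB) (m<n⊔o⇒m<n⊎m<o (a i) (b i) (proj₁ y<bounds)) ,
      ⊎-map (reach TX) (λ y<l → reach TA (m<n⊓o⇒m<n _ _ y<l) , reach TB (m<n⊓o⇒m<o _ _ y<l))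
            (proj₂ y<bounds)
      where
      ≤pos : ∀ {S} (T : PathTransversal S) → Reachable S v → y ≤ pos T i
      ≤pos T r = edge-from-reach⇒≤pos T r e (<⇒≤ 1<y) (<⇒≤ y<L)
      reach : ∀ {S} (T : PathTransversal S) → y < pos T i → Reachable S (u i y)
      reach T = reach-before-pos T (<⇒≤ 1<y)
      y≤r : y ≤ a i ⊔ b i
      y≤r = [ (λ r → m≤n⇒m≤n⊔o (b i) (≤pos TA r)) , (λ r → m≤n⇒m≤o⊔n (a i) (≤pos TB r)) ] inAB
      y≤ξ∨l : y ≤ ξ i ⊎ y ≤ a i ⊓ b i
      y≤ξ∨l = ⊎-map (≤pos TX) (λ (rA , rB) → ⊓-glb (≤pos TA rA) (≤pos TB rB)) inX
      y<bounds : y < a i ⊔ b i × (y < ξ i ⊎ y < a i ⊓ b i)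
      y<bounds = ≤∧≢phi⇒< (m⊓n≤m⊔n (a i) (b i)) y≤r y≤ξ∨l y≢φ

    module _ (fX : Subset n)
             (fX-image : ∀ v → (v ∈ fX) ⇔ (∃[ i ] ∃[ x ] (1 < x × x < L i × u i x ∈ X
                                         × v ≡ u i (phi (a i ⊓ b i) (a i ⊔ b i) x)))) where

      ∈fX⇒ : ∀ {v} → v ∈ fX → ∃[ i ] v ≡ u i (φ i)
      ∈fX⇒ {v} v∈fX with Equivalence.to (fX-image v) v∈fX
      ... | i , x , 1<x , x<L , ux∈X , v≡ with pos-unique TX (<⇒≤ 1<x) (<⇒≤ x<L) ux∈X
      ...   | refl = i , v≡

      φ∈fX : ∀ i → u i (φ i) ∈ fX
      φ∈fX i = Equivalence.from (fX-image _) (i , ξ i , 1<pos TX i , pos<L TX i , pos∈ TX i , refl)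

      Zone-step-separator : ∀ {v w S} (T : PathTransversal S) → Zone v → E v w → w ∉ fX → w ∈ S → Zone w
      Zone-step-separator T z e w∉fX w∈S with ∈⇒pos T w∈S
      ... | i , refl = Zone-step-path z e pos≢φ (1<pos T i) (pos<L T i)
        where pos≢φ = λ pos≡φ → w∉fX (subst (λ y → u i y ∈ fX) (sym pos≡φ) (φ∈fX i))

      Zone-step : ∀ {v w} → Zone v → E v w → w ∉ fX → Zone w
      Zone-step {w = w} z e w∉fX with w ∈? A | w ∈? B | w ∈? X
      ... | yes w∈A | _       | _       = Zone-step-separator TA z e w∉fX w∈A
      ... | no  _   | yes w∈B | _       = Zone-step-separator TB z e w∉fX w∈B
      ... | no  _   | no  _   | yes w∈X = Zone-step-separator TX z e w∉fX w∈X
      ... | no  w∉A | no  w∉B | no  w∉X = Zone-step-outside z e w∉A w∉B w∉X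

      reach⇒Zone : ∀ {w} → Reach G fX s w → Zone w
      reach⇒Zone (here _)        = s∈Zone
      reach⇒Zone (step r e w∉fX) = Zone-step (reach⇒Zone r) e w∉fX

      fX-separates : IsSep G s t fX
      fX-separates = s∉fX , t∉fX , t∉Zone ∘ reach⇒Zone
        where
        s∉fX : s ∉ fX
        s∉fX s∈fX with ∈fX⇒ s∈fX
        ... | i , s≡uφ = inner≢s (1<φ i) (<⇒≤ (φ<L i)) (sym s≡uφ)
        t∉fX : t ∉ fX
        t∉fX t∈fX with ∈fX⇒ t∈fX
        ... | i , t≡uφ = inner≢t (<⇒≤ (1<φ i)) (φ<L i) (sym t≡uφ)

      ∣fX∣≤k : ∣ fX ∣ ≤ k
      ∣fX∣≤k = ⊆image⇒∣p∣≤ (λ i → u i (φ i)) ∈fX⇒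

lemma2 : ∀ {n} (G : SimpleGraph n) (s t : Fin n) → s ≢ t
  → ¬ SimpleGraph.E G s t → (k : ℕ) (P : CanonicalPaths G s t k)
  → (A B : Subset n) → IsMinSep G s t A → IsMinSep G s t B → ∣ A ∣ ≡ k
  → (a b : Fin k → ℕ)
  → (∀ i → 1 ≤ a i × a i ≤ CanonicalPaths.L P i × CanonicalPaths.u P i (a i) ∈ A)
  → (∀ i → 1 ≤ b i × b i ≤ CanonicalPaths.L P i × CanonicalPaths.u P i (b i) ∈ B)
  → (X : Subset n) → IsMinSep G s t X
  → (fX : Subset n)
  → (∀ v → (v ∈ fX) ⇔ (∃[ i ] ∃[ x ] (1 < x × x < CanonicalPaths.L P i
       × CanonicalPaths.u P i x ∈ X
       × v ≡ CanonicalPaths.u P i (phi (a i ⊓ b i) (a i ⊔ b i) x))))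
  → IsMinSep G s t fX
lemma2 G s t _ _ k P A B (sepA , minA) (sepB , minB) ∣A∣≡k a b a-meets b-meets
       X (sepX , minX) fX fX-image =
  fX-separates fX fX-image ,
  λ T sepT → ≤-trans (∣fX∣≤k fX fX-image) (subst (_≤ ∣ T ∣) ∣A∣≡k (minA T sepT))
  where
  open Paths G P
  minimum⇒≤k : ∀ S → (∀ T → IsSep G s t T → ∣ S ∣ ≤ ∣ T ∣) → ∣ S ∣ ≤ k
  minimum⇒≤k S minS = subst (∣ S ∣ ≤_) ∣A∣≡k (minS A sepA)
  open Uncrossing
    (transversal sepA a a-meets (minimum⇒≤k A minA))
    (transversal sepB b b-meets (minimum⇒≤k B minB))
    (transversal sepX (proj₁ ∘ separator-meets sepX) (proj₂ ∘ separator-meets sepX) (minimum⇒≤k X minX))
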